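{- Let $g,n\ge0$ with $3g-3+n>0$ and let $(\mathbf G,\tau)$ be any edge-labelled pair. Then the total cycle set $\mathcal O^{\mathbf G}_\tau$ is uniquely determined by the nonloop contraction deck $\mathcal D^{\mathbf G}_\tau$; i.e. if $(\mathbf G',\tau')$ is another edge-labelled pair with $\mathcal D^{\mathbf G'}_{\tau'}\cong\mathcal D^{\mathbf G}_\tau$ then $\mathcal O^{\mathbf G'}_{\tau'}=\mathcal O^{\mathbf G}_\tau$.
   Context: $I_n=\{1,\dots,n\}$; $[p]=\{0,\dots,p\}$. A graph $G$ is a finite set $X(G)=V(G)\sqcup H(G)$ with maps $s,r$ ($s^2=\mathrm{id}$, $r^2=r$, both with fixed-point set $V(G)$); $r$ gives the vertex of a half-edge, edges are $s$-orbits in $H(G)$ (loops, multiple edges allowed); graphs are connected, $b^1(G)=|E|-|V|+1$, $\mathrm{val}(v)$ = number of half-edges at $v$. A stable $n$-marked weighted graph of genus $g$ is $\mathbf G=(G,w,m)$, $w:V\to\mathbb Z_{\ge0}$, $m:I_n\to V$, with $b^1(G)+\sum w(v)=g$ and $2w(v)-2+\mathrm{val}(v)+|m^{ -1}(v)|>0$ for all $v$; isomorphisms preserve $r,s,w,m$. Contracting a loop deletes it and adds 1 to its vertex weight; contracting a non-loop edge merges its endpoints (weights summed, markings united). An edge-labelled pair $(\mathbf G,\tau)$ is such a graph with a bijection $\tau:E(\mathbf G)\to[p]$; pairs are isomorphic if an isomorphism respects labels. For $j\in[p]$ let $e_j=\tau^{ -1}(j)$ and $(\mathbf G/e_j,\tau_j)$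 the contraction of $e_j$, relabelled by the order-preserving bijection $[p]\smallsetminus\{j\}\to[p-1]$. The nonloop contraction deck $\mathcal D^{\mathbf G}_\tau$ is the indexed list $\{((\mathbf G/e_j,\tau_j),j): e_j\text{ not a loop}\}$; two lists are equivalent if they have the same index set and isomorphic pairs at each index. A $k$-cycle is a set of $k$ edges forming a cycle (a $1$-cycle is a loop, a $2$-cycle a pair of parallel non-loop edges). The total cycle set is $\mathcal O^{\mathbf G}_\tau=\bigsqcup_{k\ge1}\{S\subseteq[p]: |S|=k,\ \{e_i\}_{i\in S}\text{ is a }k\text{ -cycle of }\mathbf G\}$. -}

module Defs where

open import Data.Nat using (ℕ; zero; suc; _+_; _*_; _<_)
open import Data.Bool using (Bool; true; false)
open import Data.Fin using (Fin; punchIn; punchOut)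
open import Data.Fin.Properties using (_≟_)
open import Data.Fin.Subset using (Subset; _∈_)
open import Data.Fin.Subset.Properties using (_∈?_)
open import Data.List using (List; []; _∷_; length; filter; allFin; concatMap; map)
open import Data.Nat.ListAction using (sum)
open import Data.Product using (Σ; ∃; _×_; _,_; proj₁; proj₂)
open import Data.Sum using (_⊎_)
open import Data.Empty using (⊥-elim)
open import Function.Bundles using (_↔_; Inverse; _⇔_)
open import Relation.Nullary using (¬_)
open import Relation.Nullary.Decidable using (_×-dec_)
open import Relation.Binary.PropositionalEquality using (_≡_; _≢_; sym)
open import Relation.Binary.Construct.Closure.ReflexiveTransitive using (Star)

-- An n-marked weighted graph whose k edges are labelled by Fin k
-- (Fin (suc p) plays the role of [p] = {0,…,p}).  The half-edges are
-- H = Fin k × Bool, the involution s is (j , b) ↦ (j , not b) (so the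
-- s-orbit of (j , b) is the edge labelled j), and r sends a half-edge to
-- its vertex.
record LGraph (n k : ℕ) : Set where
  field
    nv : ℕ
    r  : Fin k → Bool → Fin nv
    w  : Fin nv → ℕ
    m  : Fin n → Fin nv
open LGraph public

HalfEdge : ℕ → Set
HalfEdge k = Fin k × Bool

halfEdges : (k : ℕ) → List (HalfEdge k)
halfEdges k = concatMap (λ j → (j , false) ∷ (j , true) ∷ []) (allFin k)

module _ {n k : ℕ} (G : LGraph n k) where

  rh : HalfEdge k → Fin (nv G)
  rh (j , b) = r G j b

  val : Fin (nv G) → ℕ
  val v = length (filter (λ h → rh h ≟ v) (halfEdges k))

  marks : Fin (nv G) → ℕ
  marks v = length (filter (λ i → m G i ≟ v) (allFin n))

  totalWeight : ℕ
  totalWeight = sum (map (w G) (allFin (nv G)))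

  Adjacent : Fin (nv G) → Fin (nv G) → Set
  Adjacent u v = ∃ λ j → (r G j false ≡ u × r G j true ≡ v) ⊎ (r G j true ≡ u × r G j false ≡ v)

  Connected : Set
  Connected = (0 < nv G) × (∀ u v → Star Adjacent u v)

  -- b¹(G) + Σ w(v) = g, with b¹(G) = |E| - |V| + 1, written without subtraction
  HasGenus : ℕ → Set
  HasGenus g = k + 1 + totalWeight ≡ g + nv G

  StableAt : Fin (nv G) → Set
  StableAt v = 2 < 2 * w G v + val v + marks v

  IsStable : ℕ → Set
  IsStable g = Connected × HasGenus g × (∀ v → StableAt v)

  NonLoop : Fin k → Set
  NonLoop j = r G j false ≢ r G j true

  degIn : Subset k → Fin (nv G) → ℕ
  degIn S v = length (filter (λ h → (proj₁ h ∈? S) ×-dec (rh h ≟ v)) (halfEdges k))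

  EdgeAdjIn : Subset k → Fin k → Fin k → Set
  EdgeAdjIn S i j = i ∈ S × j ∈ S × (∃ λ b → ∃ λ c → r G i b ≡ r G j c)

  IsCycle : Subset k → Set
  IsCycle S = (∃ λ i → i ∈ S)
            × (∀ v → degIn S v ≡ 0 ⊎ degIn S v ≡ 2)
            × (∀ i j → i ∈ S → j ∈ S → Star (EdgeAdjIn S) i j)

-- isomorphism of edge-labelled pairs: a bijection of vertices preserving
-- weights and markings, and for each label j a bijection of the two
-- half-edges of e_j onto those of e'_j compatible with r.
record LIso {n k : ℕ} (G G' : LGraph n k) : Set where
  field
    φ     : Fin (nv G) ↔ Fin (nv G')
    w-pres : ∀ v → w G' (Inverse.to φ v) ≡ w G v
    m-pres : ∀ i → m G' i ≡ Inverse.to φ (m G i)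
    r-pres : ∀ j → (r G' j false ≡ Inverse.to φ (r G j false) × r G' j true ≡ Inverse.to φ (r G j true))
                 ⊎ (r G' j false ≡ Inverse.to φ (r G j true) × r G' j true ≡ Inverse.to φ (r G j false))

-- vertex map of the contraction of a non-loop edge with endpoints u ≠ v:
-- v is merged into u and the remaining vertices are renumbered
mergeV : ∀ {N} (u v : Fin (suc N)) → u ≢ v → Fin (suc N) → Fin N
mergeV u v u≢v x with v ≟ x
... | Relation.Nullary.yes _ = punchOut {i = v} {j = u} (λ e → u≢v (sym e))
... | Relation.Nullary.no ¬p = punchOut ¬p

-- contraction of the non-loop edge e_j, with labels relabelled by the
-- order-preserving bijection [p] ∖ {j} → [p-1] (new label i is old label
-- punchIn j i).
contractAux : ∀ {n k} (N : ℕ) (r : Fin (suc k) → Bool → Fin N) (w : Fin N → ℕ)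
              (m : Fin n → Fin N) (j : Fin (suc k)) → r j false ≢ r j true → LGraph n k
contractAux zero r w m j nl with r j false
... | ()
contractAux {n} {k} (suc N) r w m j nl = record
  { nv = N
  ; r  = λ i b → q (r (punchIn j i) b)
  ; w  = λ y → sum (map w (filter (λ x → q x ≟ y) (allFin (suc N))))
  ; m  = λ i → q (m i)
  }
  where
  q : Fin (suc N) → Fin N
  q = mergeV (r j false) (r j true) nl

contract : ∀ {n k} (G : LGraph n (suc k)) (j : Fin (suc k)) → NonLoop G j → LGraph n k
contract G j nl = contractAux (nv G) (r G) (w G) (m G) j nl

-- equivalence of nonloop contraction decks: same index set (the j with e_j
-- not a loop) and isomorphic contracted pairs at each index
DeckEquiv : ∀ {n p} (G G' : LGraph n (suc p)) → Set
DeckEquiv {n} {p} G G' =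
  ∀ (j : Fin (suc p)) → (NonLoop G j ⇔ NonLoop G' j)
                       × (∀ (nl : NonLoop G j) (nl' : NonLoop G' j) → LIso (contract G j nl) (contract G' j nl'))

SameCycleSet : ∀ {n k} (G G' : LGraph n k) → Set
SameCycleSet {n} {k} G G' = ∀ (S : Subset k) → IsCycle G S ⇔ IsCycle G' S

module Submission where

-- A set S of labels is a cycle of G exactly when it has one of two shapes
-- (CycleCriterion.criterion): S = {i} for a loop e_i, or S is nonempty and for
-- every i ∈ S the edge e_i is a non-loop and S ∖ i is a cycle of the
-- contraction G/e_i.  Both shapes are read off from the deck: its index set
-- says which labels are loops, and cycles are preserved by isomorphisms of the
-- contracted pairs (shape-transfer).  So graphs with equivalent decks have the
-- same cycles.

open import Defs
open import Data.Nat using (ℕ; zero; suc; _+_; _*_; _<_; _≤_; _<?_; _∸_; z≤n; s≤s)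
open import Data.Nat.Properties
  using (+-0-commutativeMonoid; +-commutativeSemigroup; +-comm; +-suc; +-mono-≤; +-monoʳ-≤;
         +-cancelʳ-≡; m+1+n≢0; m≤m+n; m≤n+m; n≤0⇒n≡0; ≮⇒≥;
         ≤-trans; <-irrefl; *-distribˡ-+; *-zeroʳ; +-identityʳ; suc-injective)
open import Data.Bool using (Bool; true; false; not)
open import Data.Fin using (Fin; punchIn; punchOut) renaming (zero to fzero; suc to fsuc)
open import Data.Fin.Properties
  using (_≟_; any?; punchInᵢ≢i; punchIn-injective; punchOut-punchIn; punchIn-punchOut;
         punchOut-injective; punchOut-cong)
open import Data.Fin.Subset using (Subset; _∈_)
open import Data.Fin.Subset.Properties using (_∈?_)
open import Data.Vec using (removeAt; lookup)
open import Data.Vec.Properties using (removeAt-punchOut; []=⇒lookup; lookup⇒[]=)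
open import Data.List using (List; []; _∷_; _++_; length; filter; concatMap; tabulate)
open import Data.List.Properties using (filter-++; length-++)
open import Algebra.Properties.CommutativeSemigroup +-commutativeSemigroup using (interchange)
open import Algebra.Properties.CommutativeMonoid.Sum +-0-commutativeMonoid
  using (sum; sum-remove; sum-cong-≗; sum-replicate-zero; ∑-distrib-+)
open import Data.Product using (Σ; ∃; _×_; _,_; proj₁; proj₂)
open import Data.Sum using (_⊎_; inj₁; inj₂; map₂; [_,_])
open import Data.Empty using (⊥-elim)
open import Function using (_∘_; id)
open import Function.Bundles using (Inverse; Equivalence; _⇔_; mk⇔; mk↔ₛ′)
open import Relation.Nullary using (¬_; Dec; yes; no)
open import Relation.Nullary.Decidable using (_×-dec_; decidable-stable)
open import Relation.Unary using (Decidable)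
open import Relation.Binary.PropositionalEquality
  using (_≡_; _≢_; refl; sym; trans; cong; cong₂; subst; subst₂; module ≡-Reasoning)
open import Relation.Binary.Construct.Closure.ReflexiveTransitive as Star
  using (Star; ε; _◅_; _◅◅_)

𝟙 : ∀ {a} {A : Set a} → Dec A → ℕ
𝟙 (yes _) = 1
𝟙 (no _)  = 0

𝟙-⇔ : ∀ {A B : Set} → (A → B) → (B → A) → (a : Dec A) (b : Dec B) → 𝟙 a ≡ 𝟙 b
𝟙-⇔ f g (yes _) (yes _) = refl
𝟙-⇔ f g (yes a) (no ¬b) = ⊥-elim (¬b (f a))
𝟙-⇔ f g (no ¬a) (yes b) = ⊥-elim (¬a (g b))
𝟙-⇔ f g (no _)  (no _)  = refl

𝟙-yes : ∀ {A : Set} → A → (a : Dec A) → 𝟙 a ≡ 1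
𝟙-yes x (yes _) = refl
𝟙-yes x (no ¬a) = ⊥-elim (¬a x)

𝟙-no : ∀ {A : Set} → ¬ A → (a : Dec A) → 𝟙 a ≡ 0
𝟙-no ¬x (yes a) = ⊥-elim (¬x a)
𝟙-no ¬x (no _)  = refl

𝟙-× : ∀ {A B : Set} (a : Dec A) (b : Dec B) → 𝟙 (a ×-dec b) ≡ 𝟙 a * 𝟙 b
𝟙-× (yes _) (yes _) = refl
𝟙-× (yes _) (no _)  = refl
𝟙-× (no _)  _       = refl

term≤sum : ∀ {k} (f : Fin k → ℕ) l → f l ≤ sum f
term≤sum {suc k} f l = subst (f l ≤_) (sym (sum-remove {i = l} f)) (m≤m+n _ _)

twoTerms≤sum : ∀ {k} (f : Fin k → ℕ) i j → i ≢ j → f i + f j ≤ sum f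
twoTerms≤sum {suc k} f i j i≢j =
  subst (f i + f j ≤_) (sym (sum-remove {i = i} f))
    (+-monoʳ-≤ (f i) (subst (λ z → f z ≤ sum (f ∘ punchIn i)) (punchIn-punchOut i≢j)
                       (term≤sum (f ∘ punchIn i) (punchOut i≢j))))

sum-zero : ∀ {k} (f : Fin k → ℕ) → (∀ l → f l ≡ 0) → sum f ≡ 0
sum-zero {k} f f≡0 = trans (sum-cong-≗ f≡0) (sum-replicate-zero k)

sum-pos : ∀ {k} (f : Fin k → ℕ) → 0 < sum f → ∃ λ l → 0 < f l
sum-pos f pos with any? (λ l → 0 <? f l)
... | yes found = found
... | no none = ⊥-elim (<-irrefl refl (subst (0 <_) (sum-zero f allZero) pos))
  where
  allZero : ∀ l → f l ≡ 0
  allZero l = n≤0⇒n≡0 (≮⇒≥ (λ pos-l → none (l , pos-l)))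

∈-removeAt : ∀ {k} (S : Subset (suc k)) i l → l ∈ removeAt S i ⇔ punchIn i l ∈ S
∈-removeAt S i l = mk⇔ (λ p → lookup⇒[]= _ S (trans (sym lookup-removeAt) ([]=⇒lookup p)))
                       (λ p → lookup⇒[]= l _ (trans lookup-removeAt ([]=⇒lookup p)))
  where
  lookup-removeAt : lookup (removeAt S i) l ≡ lookup S (punchIn i l)
  lookup-removeAt = subst (λ l′ → lookup (removeAt S i) l′ ≡ lookup S (punchIn i l))
                          (punchOut-punchIn i) (removeAt-punchOut S (punchInᵢ≢i i l ∘ sym))

punchOut-∈-removeAt : ∀ {k} (S : Subset (suc k)) {i j} (i≢j : i ≢ j) → j ∈ S → punchOut i≢j ∈ removeAt S i
punchOut-∈-removeAt S {i} i≢j j∈S =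
  Equivalence.from (∈-removeAt S i _) (subst (_∈ S) (sym (punchIn-punchOut i≢j)) j∈S)

firstExit : ∀ {k} {R : Fin k → Fin k → Set} {a b} → Star R a b → a ≢ b → ∃ λ z → R a z × z ≢ a
firstExit ε a≢b = ⊥-elim (a≢b refl)
firstExit {a = a} (_◅_ {j = z} step rest) a≢b with z ≟ a
... | no z≢a = z , step , z≢a
... | yes refl = firstExit rest a≢b

length-filter-single : ∀ {B : Set} {P : B → Set} (P? : Decidable P) a →
                       length (filter P? (a ∷ [])) ≡ 𝟙 (P? a)
length-filter-single P? a with P? a
... | yes _ = refl
... | no _  = refl

length-filter-pair : ∀ {B : Set} {P : B → Set} (P? : Decidable P) a b →
                     length (filter P? (a ∷ b ∷ [])) ≡ 𝟙 (P? a) + 𝟙 (P? b)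
length-filter-pair P? a b with P? a
... | yes _ = cong suc (length-filter-single P? b)
... | no _  = length-filter-single P? b

length-filter-halfEdges : ∀ {K} {P : HalfEdge K → Set} (P? : Decidable P) {k} (h : Fin k → Fin K) →
  length (filter P? (concatMap (λ j → (j , false) ∷ (j , true) ∷ []) (tabulate h)))
    ≡ sum (λ j → 𝟙 (P? (h j , false)) + 𝟙 (P? (h j , true)))
length-filter-halfEdges P? {zero} h = refl
length-filter-halfEdges {K} P? {suc k} h = begin
    length (filter P? (pair (h fzero) ++ rest))
  ≡⟨ cong length (filter-++ P? (pair (h fzero)) rest) ⟩
    length (filter P? (pair (h fzero)) ++ filter P? rest)
  ≡⟨ length-++ (filter P? (pair (h fzero))) ⟩
    length (filter P? (pair (h fzero))) + length (filter P? rest)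
  ≡⟨ cong₂ _+_ (length-filter-pair P? _ _) (length-filter-halfEdges P? (h ∘ fsuc)) ⟩
    𝟙 (P? (h fzero , false)) + 𝟙 (P? (h fzero , true))
      + sum (λ j → 𝟙 (P? (h (fsuc j) , false)) + 𝟙 (P? (h (fsuc j) , true))) ∎
  where
  open ≡-Reasoning
  pair : Fin K → List (HalfEdge K)
  pair j = (j , false) ∷ (j , true) ∷ []
  rest : List (HalfEdge K)
  rest = concatMap pair (tabulate (h ∘ fsuc))

ZeroOrTwo : ℕ → Set
ZeroOrTwo d = d ≡ 0 ⊎ d ≡ 2

-- The sum of the degrees at the two ends of a contracted edge.
TwoOrFour : ℕ → Set
TwoOrFour d = d ≡ 2 ⊎ d ≡ 4

zeroOrTwo-2+ : ∀ a → TwoOrFour (2 + a) → ZeroOrTwo a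
zeroOrTwo-2+ a (inj₁ 2+a≡2) = inj₁ (suc-injective (suc-injective 2+a≡2))
zeroOrTwo-2+ a (inj₂ 2+a≡4) = inj₂ (suc-injective (suc-injective 2+a≡4))

twoOrFour-≥2 : ∀ a b → 2 ≤ a → 2 ≤ b → TwoOrFour (a + b) → a ≡ 2
twoOrFour-≥2 (suc zero)          _             (s≤s ()) _ _
twoOrFour-≥2 (suc (suc zero))    _             _ _ _ = refl
twoOrFour-≥2 (suc (suc (suc a))) (suc zero)    _ (s≤s ()) _
twoOrFour-≥2 (suc (suc (suc a))) (suc (suc b)) _ _ (inj₂ sum≡4) =
  ⊥-elim (m+1+n≢0 a (suc-injective (trans (sym (+-suc a (suc b)))
                                          (suc-injective (suc-injective (suc-injective sum≡4))))))

zeroOrTwo-≥1 : ∀ {a} → 1 ≤ a → ZeroOrTwo a → a ≡ 2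
zeroOrTwo-≥1 ()  (inj₁ refl)
zeroOrTwo-≥1 _   (inj₂ a≡2) = a≡2

IsEnd : ∀ {n k} (G : LGraph n k) → Fin k → Fin (nv G) → Set
IsEnd G j x = ∃ λ b → r G j b ≡ x

isEnd? : ∀ {n k} (G : LGraph n k) j x → Dec (IsEnd G j x)
isEnd? G j x with r G j false ≟ x | r G j true ≟ x
... | yes e | _     = yes (false , e)
... | no _  | yes e = yes (true , e)
... | no e₀ | no e₁ = no λ { (false , e) → e₀ e ; (true , e) → e₁ e }

-- Degrees of vertices in the subgraph spanned by an edge set S, written as a
-- sum over the edges of their contributions; this is what makes degrees
-- computable edge by edge under contraction and isomorphism.
module Degree {n k : ℕ} (G : LGraph n k) where

  hits : Fin (nv G) → Fin k → ℕ
  hits x j = 𝟙 (r G j false ≟ x) + 𝟙 (r G j true ≟ x)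

  inc : Subset k → Fin (nv G) → Fin k → ℕ
  inc S x j = 𝟙 (j ∈? S) * hits x j

  deg : Subset k → Fin (nv G) → ℕ
  deg S x = sum (inc S x)

  degIn≡deg : ∀ S x → degIn G S x ≡ deg S x
  degIn≡deg S x = trans (length-filter-halfEdges (λ h → (proj₁ h ∈? S) ×-dec (rh G h ≟ x)) id)
                        (sum-cong-≗ edgeCount)
    where
    edgeCount : ∀ j → 𝟙 ((j ∈? S) ×-dec (r G j false ≟ x)) + 𝟙 ((j ∈? S) ×-dec (r G j true ≟ x))
                      ≡ inc S x j
    edgeCount j = trans (cong₂ _+_ (𝟙-× (j ∈? S) _) (𝟙-× (j ∈? S) _))
                        (sym (*-distribˡ-+ (𝟙 (j ∈? S)) _ _))

  cycleDegrees : ∀ {S} → IsCycle G S → ∀ x → ZeroOrTwo (deg S x)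
  cycleDegrees {S} (_ , degrees , _) x = subst ZeroOrTwo (degIn≡deg S x) (degrees x)

  degreesInCycle : ∀ {S} → (∀ x → ZeroOrTwo (deg S x)) → ∀ x → ZeroOrTwo (degIn G S x)
  degreesInCycle {S} degrees x = subst ZeroOrTwo (sym (degIn≡deg S x)) (degrees x)

  inc-member : ∀ {S j} → j ∈ S → ∀ x → inc S x j ≡ hits x j
  inc-member {S} {j} j∈S x = trans (cong (_* hits x j) (𝟙-yes j∈S (j ∈? S))) (+-identityʳ _)

  inc-nonMember : ∀ {S j} → ¬ j ∈ S → ∀ x → inc S x j ≡ 0
  inc-nonMember {S} {j} j∉S x = cong (_* hits x j) (𝟙-no j∉S (j ∈? S))

  inc-pos : ∀ S x j → 0 < inc S x j → j ∈ S × IsEnd G j x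
  inc-pos S x j pos with j ∈? S | r G j false ≟ x | r G j true ≟ x
  ... | yes j∈S | yes e | _     = j∈S , false , e
  ... | yes j∈S | no _  | yes e = j∈S , true , e
  ... | yes _   | no _  | no _  = ⊥-elim (<-irrefl refl pos)
  ... | no _    | _     | _     = ⊥-elim (<-irrefl refl pos)

  inc≥1 : ∀ {S j x} → j ∈ S → IsEnd G j x → 1 ≤ inc S x j
  inc≥1 {S} {j} {x} j∈S (b , e) = subst (1 ≤_) (sym (inc-member j∈S x)) (hit b e)
    where
    hit : ∀ b → r G j b ≡ x → 1 ≤ hits x j
    hit false e rewrite 𝟙-yes e (r G j false ≟ x) = s≤s z≤n
    hit true  e rewrite 𝟙-yes e (r G j true ≟ x) = m≤n+m 1 _

  inc-loop : ∀ {S j} → j ∈ S → r G j false ≡ r G j true → inc S (r G j false) j ≡ 2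
  inc-loop {S} {j} j∈S loop
    rewrite inc-member j∈S (r G j false) | 𝟙-yes refl (r G j false ≟ r G j false)
          | 𝟙-yes (sym loop) (r G j true ≟ r G j false) = refl

  inc-nonLoop : ∀ {S j} → j ∈ S → NonLoop G j → ∀ b → inc S (r G j b) j ≡ 1
  inc-nonLoop {S} {j} j∈S nl b = trans (inc-member j∈S _) (ends b)
    where
    ends : ∀ b → hits (r G j b) j ≡ 1
    ends false rewrite 𝟙-yes refl (r G j false ≟ r G j false)
                     | 𝟙-no (nl ∘ sym) (r G j true ≟ r G j false) = refl
    ends true  rewrite 𝟙-no nl (r G j false ≟ r G j true)
                     | 𝟙-yes refl (r G j true ≟ r G j true) = refl

  deg≥1 : ∀ {S j x} → j ∈ S → IsEnd G j x → 1 ≤ deg S x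
  deg≥1 {S} {j} {x} j∈S end = ≤-trans (inc≥1 j∈S end) (term≤sum (inc S x) j)

  deg≥2 : ∀ {S j j′ x} → j ≢ j′ → j ∈ S → IsEnd G j x → j′ ∈ S → IsEnd G j′ x → 2 ≤ deg S x
  deg≥2 {S} {x = x} j≢j′ j∈S end j′∈S end′ =
    ≤-trans (+-mono-≤ (inc≥1 j∈S end) (inc≥1 j′∈S end′)) (twoTerms≤sum (inc S x) _ _ j≢j′)

anotherEdgeAt : ∀ {n k} (G : LGraph n (suc k)) {S x i} → let open Degree G in
               deg S x ≡ 2 → inc S x i ≡ 1 → ∃ λ j → i ≢ j × j ∈ S × IsEnd G j x
anotherEdgeAt G {S} {x} {i} deg≡2 inc≡1 = relabel (sum-pos (inc S x ∘ punchIn i) rest-pos)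
  where
  open Degree G
  rest≡1 : sum (inc S x ∘ punchIn i) ≡ 1
  rest≡1 = suc-injective (trans (cong (_+ sum (inc S x ∘ punchIn i)) (sym inc≡1))
                                (trans (sym (sum-remove {i = i} (inc S x))) deg≡2))
  rest-pos : 0 < sum (inc S x ∘ punchIn i)
  rest-pos = subst (0 <_) (sym rest≡1) (s≤s z≤n)
  relabel : (∃ λ l → 0 < inc S x (punchIn i l)) → ∃ λ j → i ≢ j × j ∈ S × IsEnd G j x
  relabel (l , pos) = punchIn i l , punchInᵢ≢i i l ∘ sym , inc-pos S x (punchIn i l) pos

-- An isomorphism of edge-labelled pairs maps ends of e_j to ends of e_j, hence
-- preserves all degrees and adjacencies of every edge set, hence cycles.
module Isomorphism {n k : ℕ} {A B : LGraph n k} (I : LIso A B) where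
  open LIso I
  open Degree using (hits; inc; deg)

  to : Fin (nv A) → Fin (nv B)
  to = Inverse.to φ

  from : Fin (nv B) → Fin (nv A)
  from = Inverse.from φ

  inverse : LIso B A
  inverse = record
    { φ      = mk↔ₛ′ from to (Inverse.strictlyInverseʳ φ) (Inverse.strictlyInverseˡ φ)
    ; w-pres = λ y → trans (sym (w-pres (from y))) (cong (w B) (Inverse.strictlyInverseˡ φ y))
    ; m-pres = λ i → back (m-pres i)
    ; r-pres = r-pres⁻¹ }
    where
    back : ∀ {a c} → c ≡ to a → a ≡ from c
    back {a} e = trans (sym (Inverse.strictlyInverseʳ φ a)) (cong from (sym e))
    r-pres⁻¹ : ∀ j → (r A j false ≡ from (r B j false) × r A j true ≡ from (r B j true))
                   ⊎ (r A j false ≡ from (r B j true) × r A j true ≡ from (r B j false))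
    r-pres⁻¹ j with r-pres j
    ... | inj₁ (e₀ , e₁) = inj₁ (back e₀ , back e₁)
    ... | inj₂ (e₀ , e₁) = inj₂ (back e₁ , back e₀)

  𝟙-to : ∀ {a c} x → c ≡ to a → 𝟙 (c ≟ to x) ≡ 𝟙 (a ≟ x)
  𝟙-to {a} {c} x c≡a = 𝟙-⇔ to-injective (λ a≡x → trans c≡a (cong to a≡x)) (c ≟ to x) (a ≟ x)
    where
    to-injective : c ≡ to x → a ≡ x
    to-injective c≡x = trans (sym (Inverse.strictlyInverseʳ φ a))
                             (trans (cong from (trans (sym c≡a) c≡x)) (Inverse.strictlyInverseʳ φ x))

  hits-to : ∀ x j → hits B (to x) j ≡ hits A x j
  hits-to x j with r-pres j
  ... | inj₁ (e₀ , e₁) = cong₂ _+_ (𝟙-to x e₀) (𝟙-to x e₁)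
  ... | inj₂ (e₀ , e₁) = trans (cong₂ _+_ (𝟙-to x e₀) (𝟙-to x e₁)) (+-comm (𝟙 (r A j true ≟ x)) _)

  deg-to : ∀ S x → deg B S (to x) ≡ deg A S x
  deg-to S x = sum-cong-≗ (λ j → cong (𝟙 (j ∈? S) *_) (hits-to x j))

  endImage : ∀ j b → ∃ λ b′ → r B j b′ ≡ to (r A j b)
  endImage j b with r-pres j | b
  ... | inj₁ (e₀ , e₁) | false = false , e₀
  ... | inj₁ (e₀ , e₁) | true  = true , e₁
  ... | inj₂ (e₀ , e₁) | false = true , e₁
  ... | inj₂ (e₀ , e₁) | true  = false , e₀

  adjacency-to : ∀ S {i j} → EdgeAdjIn A S i j → EdgeAdjIn B S i j
  adjacency-to S {i} {j} (i∈S , j∈S , b , c , e) with endImage i b | endImage j c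
  ... | b′ , e₀ | c′ , e₁ = i∈S , j∈S , b′ , c′ , trans e₀ (trans (cong to e) (sym e₁))

  cycle-to : ∀ {S} → IsCycle A S → IsCycle B S
  cycle-to {S} cyc@(nonempty , _ , connected) =
    nonempty , Degree.degreesInCycle B degrees ,
    λ i j i∈S j∈S → Star.map (adjacency-to S) (connected i j i∈S j∈S)
    where
    degrees : ∀ y → ZeroOrTwo (deg B S y)
    degrees y = subst ZeroOrTwo
                  (trans (sym (deg-to S (from y))) (cong (deg B S) (Inverse.strictlyInverseˡ φ y)))
                  (Degree.cycleDegrees A cyc (from y))

module _ {N : ℕ} (u v : Fin (suc N)) (u≢v : u ≢ v) where
  private
    q : Fin (suc N) → Fin N
    q = mergeV u v u≢v

  mergeV-merges : q u ≡ q v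
  mergeV-merges with v ≟ u | v ≟ v
  ... | yes v≡u | _       = ⊥-elim (u≢v (sym v≡u))
  ... | no _    | yes _   = punchOut-cong v refl
  ... | no _    | no v≢v  = ⊥-elim (v≢v refl)

  mergeV-injective : ∀ x y → q x ≡ q y → x ≡ y ⊎ ((x ≡ u ⊎ x ≡ v) × (y ≡ u ⊎ y ≡ v))
  mergeV-injective x y qx≡qy with v ≟ x | v ≟ y
  ... | yes v≡x | yes v≡y = inj₁ (trans (sym v≡x) v≡y)
  ... | yes v≡x | no v≢y  = inj₂ (inj₂ (sym v≡x) , inj₁ (sym (punchOut-injective (u≢v ∘ sym) v≢y qx≡qy)))
  ... | no v≢x  | yes v≡y = inj₂ (inj₁ (punchOut-injective v≢x (u≢v ∘ sym) qx≡qy) , inj₂ (sym v≡y))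
  ... | no v≢x  | no v≢y  = inj₁ (punchOut-injective v≢x v≢y qx≡qy)

  mergeV-onto : ∀ y → q (punchIn v y) ≡ y
  mergeV-onto y with v ≟ punchIn v y
  ... | yes v≡ = ⊥-elim (punchInᵢ≢i v y (sym v≡))
  ... | no _   = trans (punchOut-cong v refl) (punchOut-punchIn v)

record ContractionMap {n k : ℕ} (G : LGraph n (suc k)) (i : Fin (suc k)) (C : LGraph n k) : Set where
  field
    q            : Fin (nv G) → Fin (nv C)
    r-image      : ∀ l b → r C l b ≡ q (r G (punchIn i l) b)
    merges       : q (r G i false) ≡ q (r G i true)
    q-injective  : ∀ x y → q x ≡ q y → x ≡ y ⊎ (IsEnd G i x × IsEnd G i y)
    q-surjective : ∀ y → ∃ λ x → q x ≡ y

contractionMap : ∀ {n k} (G : LGraph n (suc k)) i (nl : NonLoop G i) → ContractionMap G i (contract G i nl)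
contractionMap {n} {k} G i nl = build (nv G) (r G) (w G) (m G) nl
  where
  build : ∀ N (r : Fin (suc k) → Bool → Fin N) (w : Fin N → ℕ) (m : Fin n → Fin N)
          (nl : r i false ≢ r i true) →
          ContractionMap (record { nv = N ; r = r ; w = w ; m = m }) i (contractAux N r w m i nl)
  build zero r w m nl with r i false
  ... | ()
  build (suc N) r w m nl = record
    { q            = mergeV u v nl
    ; r-image      = λ l b → refl
    ; merges       = mergeV-merges u v nl
    ; q-injective  = λ x y e → map₂ (λ (x≈ , y≈) → end x≈ , end y≈) (mergeV-injective u v nl x y e)
    ; q-surjective = λ y → punchIn v y , mergeV-onto u v nl y }
    where
    u = r i false
    v = r i true
    end : ∀ {x} → x ≡ u ⊎ x ≡ v → ∃ λ b → r i b ≡ x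
    end (inj₁ x≡u) = false , sym x≡u
    end (inj₂ x≡v) = true , sym x≡v

-- Away from
-- the ends of e_i nothing changes; the merged vertex q u collects the degrees of
-- both ends, minus the two half-edges of e_i when i ∈ S.
module Contraction {n k : ℕ} (G : LGraph n (suc k)) (i : Fin (suc k)) (nl : NonLoop G i) where
  open ContractionMap (contractionMap G i nl) public
  open Degree using (hits; inc; deg)

  C : LGraph n k
  C = contract G i nl

  u v : Fin (nv G)
  u = r G i false
  v = r G i true

  q-end : ∀ {x} → IsEnd G i x → q x ≡ q u
  q-end (false , refl) = refl
  q-end (true  , refl) = sym merges

  𝟙-removeAt : ∀ S l → 𝟙 (l ∈? removeAt S i) ≡ 𝟙 (punchIn i l ∈? S)
  𝟙-removeAt S l = 𝟙-⇔ (Equivalence.to (∈-removeAt S i l)) (Equivalence.from (∈-removeAt S i l)) _ _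

  𝟙-image : ∀ l b y → 𝟙 (r C l b ≟ y) ≡ 𝟙 (q (r G (punchIn i l) b) ≟ y)
  𝟙-image l b y = 𝟙-⇔ (trans (sym (r-image l b))) (trans (r-image l b)) _ _

  𝟙-unmerged : ∀ {x} → ¬ IsEnd G i x → ∀ a → 𝟙 (q a ≟ q x) ≡ 𝟙 (a ≟ x)
  𝟙-unmerged {x} x∉ a = 𝟙-⇔ injective (cong q) (q a ≟ q x) (a ≟ x)
    where
    injective : q a ≡ q x → a ≡ x
    injective qa≡qx with q-injective a x qa≡qx
    ... | inj₁ a≡x = a≡x
    ... | inj₂ (_ , x∈) = ⊥-elim (x∉ x∈)

  𝟙-merged : ∀ a → 𝟙 (q a ≟ q u) ≡ 𝟙 (a ≟ u) + 𝟙 (a ≟ v)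
  𝟙-merged a with a ≟ u | a ≟ v
  ... | yes a≡u | yes a≡v = ⊥-elim (nl (trans (sym a≡u) a≡v))
  ... | yes a≡u | no _    = 𝟙-yes (cong q a≡u) (q a ≟ q u)
  ... | no _    | yes a≡v = 𝟙-yes (trans (cong q a≡v) (sym merges)) (q a ≟ q u)
  ... | no a≢u  | no a≢v  = 𝟙-no notMerged (q a ≟ q u)
    where
    notMerged : q a ≢ q u
    notMerged qa≡qu with q-injective a u qa≡qu
    ... | inj₁ a≡u = a≢u a≡u
    ... | inj₂ ((false , u≡a) , _) = a≢u (sym u≡a)
    ... | inj₂ ((true  , v≡a) , _) = a≢v (sym v≡a)

  inc-contract : ∀ S y l → inc C (removeAt S i) y l ≡ 𝟙 (punchIn i l ∈? S) * hits C y l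
  inc-contract S y l = cong (_* hits C y l) (𝟙-removeAt S l)

  hits-unmerged : ∀ {x} → ¬ IsEnd G i x → ∀ l → hits C (q x) l ≡ hits G x (punchIn i l)
  hits-unmerged x∉ l = cong₂ _+_ (trans (𝟙-image l false _) (𝟙-unmerged x∉ _))
                                 (trans (𝟙-image l true _) (𝟙-unmerged x∉ _))

  hits-merged : ∀ l → hits C (q u) l ≡ hits G u (punchIn i l) + hits G v (punchIn i l)
  hits-merged l = trans (cong₂ _+_ (trans (𝟙-image l false _) (𝟙-merged _))
                                   (trans (𝟙-image l true _) (𝟙-merged _)))
                        (interchange (𝟙 (end false ≟ u)) (𝟙 (end false ≟ v))
                                     (𝟙 (end true ≟ u)) (𝟙 (end true ≟ v)))
    where
    end : Bool → Fin (nv G)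
    end = r G (punchIn i l)

  deg-unmerged : ∀ S {x} → ¬ IsEnd G i x → deg C (removeAt S i) (q x) ≡ deg G S x
  deg-unmerged S {x} x∉ = begin
      deg C (removeAt S i) (q x)
    ≡⟨ sum-cong-≗ (λ l → trans (inc-contract S (q x) l) (cong (𝟙 (punchIn i l ∈? S) *_) (hits-unmerged x∉ l))) ⟩
      sum (inc G S x ∘ punchIn i)
    ≡⟨ cong (_+ sum (inc G S x ∘ punchIn i)) (sym (inc-i≡0)) ⟩
      inc G S x i + sum (inc G S x ∘ punchIn i)
    ≡⟨ sum-remove {i = i} (inc G S x) ⟨
      deg G S x ∎
    where
    open ≡-Reasoning
    inc-i≡0 : inc G S x i ≡ 0
    inc-i≡0 = trans (cong (𝟙 (i ∈? S) *_)
                          (cong₂ _+_ (𝟙-no (x∉ ∘ (false ,_)) (u ≟ x)) (𝟙-no (x∉ ∘ (true ,_)) (v ≟ x))))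
                    (*-zeroʳ (𝟙 (i ∈? S)))

  deg-merged : ∀ {S} → i ∈ S → deg C (removeAt S i) (q u) + 2 ≡ deg G S u + deg G S v
  deg-merged {S} i∈S = begin
      deg C (removeAt S i) (q u) + 2
    ≡⟨ cong (_+ 2) (trans (sum-cong-≗ split) (∑-distrib-+ (inc G S u ∘ punchIn i) (inc G S v ∘ punchIn i))) ⟩
      A + B + 2
    ≡⟨ trans (+-comm (A + B) 2) (cong suc (sym (+-suc A B))) ⟩
      (1 + A) + (1 + B)
    ≡⟨ cong₂ _+_ (cong (_+ A) (inc-nonLoop i∈S nl false)) (cong (_+ B) (inc-nonLoop i∈S nl true)) ⟨
      (inc G S u i + A) + (inc G S v i + B)
    ≡⟨ cong₂ _+_ (sum-remove {i = i} (inc G S u)) (sum-remove {i = i} (inc G S v)) ⟨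
      deg G S u + deg G S v ∎
    where
    open ≡-Reasoning
    open Degree G using (inc-nonLoop)
    A = sum (inc G S u ∘ punchIn i)
    B = sum (inc G S v ∘ punchIn i)
    split : ∀ l → inc C (removeAt S i) (q u) l ≡ inc G S u (punchIn i l) + inc G S v (punchIn i l)
    split l = trans (inc-contract S (q u) l)
                    (trans (cong (𝟙 (punchIn i l ∈? S) *_) (hits-merged l))
                           (*-distribˡ-+ (𝟙 (punchIn i l ∈? S)) (hits G u (punchIn i l))
                                         (hits G v (punchIn i l))))

  adjacentInC : ∀ {S l l′} b c → l ∈ removeAt S i → l′ ∈ removeAt S i →
                q (r G (punchIn i l) b) ≡ q (r G (punchIn i l′) c) → EdgeAdjIn C (removeAt S i) l l′
  adjacentInC b c l∈ l′∈ e = l∈ , l′∈ , b , c , trans (r-image _ b) (trans e (sym (r-image _ c)))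

  -- an edge w of C stands for the edge z of G if it is z relabelled, or if z = i
  -- and w is an edge of S ∖ i at the merged vertex
  StandsFor : Subset (suc k) → Fin (suc k) → Fin k → Set
  StandsFor S z w = punchIn i w ≡ z ⊎ (z ≡ i × w ∈ removeAt S i × ∃ λ c → q (r G (punchIn i w) c) ≡ q u)

  standsFor-meets : ∀ {S z w} → StandsFor S z w → z ∈ S → ∀ b →
                    w ∈ removeAt S i × ∃ λ b′ → q (r G (punchIn i w) b′) ≡ q (r G z b)
  standsFor-meets {S} {w = w} (inj₁ w↦z) z∈S b =
    Equivalence.from (∈-removeAt S i w) (subst (_∈ S) (sym w↦z) z∈S) , b , cong (λ t → q (r G t b)) w↦z
  standsFor-meets (inj₂ (z≡i , w∈ , c , meets)) z∈S b =
    w∈ , c , trans meets (sym (q-end (b , cong (λ t → r G t b) (sym z≡i))))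

  -- A path in S from z to a relabelled edge projects to a path in S ∖ i from any
  -- edge standing for z; steps through e_i become steps at the merged vertex.
  project : ∀ {S z ly} → Star (EdgeAdjIn G S) z (punchIn i ly) → ly ∈ removeAt S i →
            ∀ w → StandsFor S z w → Star (EdgeAdjIn C (removeAt S i)) w ly
  project {ly = ly} ε ly∈ w (inj₁ w↦ly) = subst (λ w′ → Star _ w′ ly) (sym (punchIn-injective i w ly w↦ly)) ε
  project ε ly∈ w (inj₂ (ly↦i , _)) = ⊥-elim (punchInᵢ≢i i _ ly↦i)
  project {S} (_◅_ {j = z₂} (z∈S , z₂∈S , b , c , e) rest) ly∈ w w~z
    with standsFor-meets w~z z∈S b | z₂ ≟ i
  ... | w∈ , b′ , meets | yes z₂≡i =
    project rest ly∈ w (inj₂ (z₂≡i , w∈ , b′ , trans meets (trans (cong q e) (q-end z₂-end))))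
    where
    z₂-end : IsEnd G i (r G z₂ c)
    z₂-end = c , cong (λ t → r G t c) (sym z₂≡i)
  ... | w∈ , b′ , meets | no z₂≢i =
    adjacentInC {S} b′ c w∈ w₂∈ (trans meets (trans (cong q e) (cong (λ t → q (r G t c)) (sym w₂↦z₂))))
    ◅ project rest ly∈ w₂ (inj₁ w₂↦z₂)
    where
    w₂ = punchOut (z₂≢i ∘ sym)
    w₂↦z₂ : punchIn i w₂ ≡ z₂
    w₂↦z₂ = punchIn-punchOut _
    w₂∈ : w₂ ∈ removeAt S i
    w₂∈ = punchOut-∈-removeAt S (z₂≢i ∘ sym) z₂∈S

  -- An adjacency in S ∖ i lifts to a path in S, detouring through e_i when the
  -- shared vertex is the merged one; hence paths in S ∖ i lift to paths in S.
  liftStep : ∀ {S} → i ∈ S → ∀ {l l′} → EdgeAdjIn C (removeAt S i) l l′ →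
             Star (EdgeAdjIn G S) (punchIn i l) (punchIn i l′)
  liftStep {S} i∈S {l} {l′} (l∈ , l′∈ , b , c , e) =
    detour (q-injective _ _ (trans (sym (r-image l b)) (trans e (r-image l′ c))))
    where
    l∈S = Equivalence.to (∈-removeAt S i l) l∈
    l′∈S = Equivalence.to (∈-removeAt S i l′) l′∈
    detour : let x = r G (punchIn i l) b ; y = r G (punchIn i l′) c in
             x ≡ y ⊎ (IsEnd G i x × IsEnd G i y) → Star (EdgeAdjIn G S) (punchIn i l) (punchIn i l′)
    detour (inj₁ same) = (l∈S , l′∈S , b , c , same) ◅ ε
    detour (inj₂ ((b₁ , e₁) , (b₂ , e₂))) = (l∈S , i∈S , b , b₁ , sym e₁) ◅ (i∈S , l′∈S , b₂ , c , e₂) ◅ ε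

  lift : ∀ {S} → i ∈ S → ∀ {l l′} → Star (EdgeAdjIn C (removeAt S i)) l l′ →
         Star (EdgeAdjIn G S) (punchIn i l) (punchIn i l′)
  lift i∈S ε = ε
  lift i∈S (step ◅ rest) = liftStep i∈S step ◅◅ lift i∈S rest

  contractCycle : ∀ {S} → i ∈ S → IsCycle G S → IsCycle C (removeAt S i)
  contractCycle {S} i∈S cyc@(_ , _ , connected) =
    nonempty , Degree.degreesInCycle C degrees , λ l l′ l∈ l′∈ → project (connected′ l∈ l′∈) l′∈ l (inj₁ refl)
    where
    open Degree G using (cycleDegrees; deg≥1; inc-nonLoop)
    deg-ends : ∀ b → deg G S (r G i b) ≡ 2
    deg-ends b with cycleDegrees cyc (r G i b)
    ... | inj₁ ≡0 = ⊥-elim (<-irrefl refl (subst (0 <_) ≡0 (deg≥1 i∈S (b , refl))))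
    ... | inj₂ ≡2 = ≡2
    nonempty : ∃ λ l → l ∈ removeAt S i
    nonempty with anotherEdgeAt G (deg-ends false) (inc-nonLoop i∈S nl false)
    ... | j , i≢j , j∈S , _ = punchOut i≢j , punchOut-∈-removeAt S i≢j j∈S
    degrees : ∀ y → ZeroOrTwo (deg C (removeAt S i) y)
    degrees y with q-surjective y
    ... | x , refl with isEnd? G i x
    ...   | no x∉ = subst ZeroOrTwo (sym (deg-unmerged S x∉)) (cycleDegrees cyc x)
    ...   | yes x∈ = inj₂ (trans (cong (deg C (removeAt S i)) (q-end x∈))
                                 (+-cancelʳ-≡ 2 _ 2 (trans (deg-merged i∈S)
                                                           (cong₂ _+_ (deg-ends false) (deg-ends true)))))
    connected′ : ∀ {l l′} → l ∈ removeAt S i → l′ ∈ removeAt S i →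
                 Star (EdgeAdjIn G S) (punchIn i l) (punchIn i l′)
    connected′ {l} {l′} l∈ l′∈ =
      connected _ _ (Equivalence.to (∈-removeAt S i l) l∈) (Equivalence.to (∈-removeAt S i l′) l′∈)

  module _ {S : Subset (suc k)} (cycleC : IsCycle C (removeAt S i)) where

    unmergedDegree : ∀ {x} → ¬ IsEnd G i x → ZeroOrTwo (deg G S x)
    unmergedDegree x∉ = subst ZeroOrTwo (deg-unmerged S x∉) (Degree.cycleDegrees C cycleC _)

    endDegrees : i ∈ S → ∀ b → TwoOrFour (deg G S (r G i b) + deg G S (r G i (not b)))
    endDegrees i∈S false with Degree.cycleDegrees C cycleC (q u)
    ... | inj₁ ≡0 = inj₁ (trans (sym (deg-merged i∈S)) (cong (_+ 2) ≡0))
    ... | inj₂ ≡2 = inj₂ (trans (sym (deg-merged i∈S)) (cong (_+ 2) ≡2))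
    endDegrees i∈S true = subst TwoOrFour (+-comm (deg G S u) _) (endDegrees i∈S false)

SingleLoop : ∀ {n k} → LGraph n (suc k) → Subset (suc k) → Set
SingleLoop {k = k} G S = Σ (Fin (suc k)) λ i → ¬ NonLoop G i × i ∈ S × (∀ j → j ∈ S → j ≡ i)

ContractsToCycles : ∀ {n k} → LGraph n (suc k) → Subset (suc k) → Set
ContractsToCycles G S = (∃ λ i → i ∈ S)
  × (∀ i → i ∈ S → Σ (NonLoop G i) λ nl → IsCycle (contract G i nl) (removeAt S i))

CycleShape : ∀ {n k} → LGraph n (suc k) → Subset (suc k) → Set
CycleShape G S = SingleLoop G S ⊎ ContractsToCycles G S

module CycleCriterion {n k : ℕ} (G : LGraph n (suc k)) where
  open Degree G

  -- a cycle through a loop consists of that loop alone: another edge adjacent to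
  -- the loop would raise the degree of its vertex to at least 3
  loopCycle-single : ∀ {S i} → IsCycle G S → i ∈ S → r G i false ≡ r G i true → ∀ j → j ∈ S → j ≡ i
  loopCycle-single {S} {i} cyc@(_ , _ , connected) i∈S loop j j∈S with j ≟ i
  ... | yes j≡i = j≡i
  ... | no j≢i with firstExit (connected i j i∈S j∈S) (j≢i ∘ sym)
  ...   | z , (_ , z∈S , b , c , e) , z≢i = ⊥-elim (notZeroOrTwo (cycleDegrees cyc u))
    where
    u = r G i false
    at-u : ∀ b → r G i b ≡ u
    at-u false = refl
    at-u true  = sym loop
    deg≥3 : 3 ≤ deg S u
    deg≥3 = ≤-trans (subst (λ d → 3 ≤ d + inc S u z) (sym (inc-loop i∈S loop))
                           (+-monoʳ-≤ 2 (inc≥1 z∈S (c , trans (sym e) (at-u b)))))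
                    (twoTerms≤sum (inc S u) i z (z≢i ∘ sym))
    notZeroOrTwo : ¬ ZeroOrTwo (deg S u)
    notZeroOrTwo (inj₁ ≡0) = <-irrefl refl (≤-trans (s≤s z≤n) (subst (3 ≤_) ≡0 deg≥3))
    notZeroOrTwo (inj₂ ≡2) = <-irrefl refl (subst (3 ≤_) ≡2 deg≥3)

  singleLoop-cycle : ∀ {S} → SingleLoop G S → IsCycle G S
  singleLoop-cycle {S} (i , notNonLoop , i∈S , only) =
    (i , i∈S) , degreesInCycle {S} degrees ,
    λ a b a∈S b∈S → subst₂ (Star (EdgeAdjIn G S)) (sym (only a a∈S)) (sym (only b b∈S)) ε
    where
    loop : r G i false ≡ r G i true
    loop = decidable-stable (r G i false ≟ r G i true) notNonLoop
    loopHits : ∀ x → ZeroOrTwo (hits x i)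
    loopHits x with r G i false ≟ x | r G i true ≟ x
    ... | yes _ | yes _ = inj₂ refl
    ... | no _  | no _  = inj₁ refl
    ... | yes e | no ¬e = ⊥-elim (¬e (trans (sym loop) e))
    ... | no ¬e | yes e = ⊥-elim (¬e (trans loop e))
    others : ∀ x l → inc S x (punchIn i l) ≡ 0
    others x l = inc-nonMember (λ p∈S → punchInᵢ≢i i l (only _ p∈S)) x
    degrees : ∀ x → ZeroOrTwo (deg S x)
    degrees x = subst ZeroOrTwo
      (sym (trans (sum-remove {i = i} (inc S x))
                  (trans (cong₂ _+_ (inc-member i∈S x) (sum-zero _ (others x))) (+-identityʳ _))))
      (loopHits x)

  -- Degrees: a vertex x
  -- off some edge of S is controlled by that edge's contraction; otherwise x is an
  -- end of two distinct edges i₀, j of S, and the other end y of e_{i₀} gives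
  -- either deg y = 2 (y off e_j) or deg x, deg y ≥ 2 (y on e_j), and in both
  -- cases deg x + deg y ∈ {2, 4} forces deg x ∈ {0, 2}.  Connectivity: an edge a
  -- meets a second edge j at an end (degree 2 there), and a path from j to b in
  -- the contraction G/e_a lifts to G.
  contracts-cycle : ∀ {S} → ContractsToCycles G S → IsCycle G S
  contracts-cycle {S} (nonempty@(i₀ , i₀∈S) , contracts) = nonempty , degreesInCycle {S} degrees , connected
    where
    module C (i : Fin (suc k)) (i∈S : i ∈ S) = Contraction G i (proj₁ (contracts i i∈S))
    cycleC : ∀ i (i∈S : i ∈ S) → IsCycle (C.C i i∈S) (removeAt S i)
    cycleC i i∈S = proj₂ (contracts i i∈S)
    offEdge : ∀ {i x} (i∈S : i ∈ S) → ¬ IsEnd G i x → ZeroOrTwo (deg S x)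
    offEdge {i} i∈S = C.unmergedDegree i i∈S {S} (cycleC i i∈S)

    -- a second edge e_j of S, from the cycle S ∖ i₀ in G/e_{i₀}
    l₀ = proj₁ (proj₁ (cycleC i₀ i₀∈S))
    j : Fin (suc k)
    j = punchIn i₀ l₀
    j∈S : j ∈ S
    j∈S = Equivalence.to (∈-removeAt S i₀ l₀) (proj₂ (proj₁ (cycleC i₀ i₀∈S)))
    i₀≢j : i₀ ≢ j
    i₀≢j = punchInᵢ≢i i₀ l₀ ∘ sym

    sharedEnd : ∀ {x b} → r G i₀ b ≡ x → IsEnd G j x → ZeroOrTwo (deg S x)
    sharedEnd {x} {b} x≡ x∈j = byOtherEnd (isEnd? G j y)
      where
      y = r G i₀ (not b)
      sumEnds : TwoOrFour (deg S x + deg S y)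
      sumEnds = subst (λ z → TwoOrFour (deg S z + deg S y)) x≡
                      (C.endDegrees i₀ i₀∈S {S} (cycleC i₀ i₀∈S) i₀∈S b)
      byOtherEnd : Dec (IsEnd G j y) → ZeroOrTwo (deg S x)
      byOtherEnd (no y∉) =
        zeroOrTwo-2+ (deg S x) (subst TwoOrFour (trans (cong (deg S x +_) deg-y≡2) (+-comm (deg S x) 2)) sumEnds)
        where
        deg-y≡2 : deg S y ≡ 2
        deg-y≡2 = zeroOrTwo-≥1 (deg≥1 i₀∈S (not b , refl)) (offEdge j∈S y∉)
      byOtherEnd (yes y∈) = inj₂ (twoOrFour-≥2 _ _ (deg≥2 i₀≢j i₀∈S (b , x≡) j∈S x∈j)
                                                  (deg≥2 i₀≢j i₀∈S (not b , refl) j∈S y∈) sumEnds)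

    degrees : ∀ x → ZeroOrTwo (deg S x)
    degrees x with isEnd? G i₀ x | isEnd? G j x
    ... | no x∉     | _       = offEdge i₀∈S x∉
    ... | yes _     | no x∉   = offEdge j∈S x∉
    ... | yes (b , x≡) | yes x∈j = sharedEnd x≡ x∈j

    connected : ∀ a b → a ∈ S → b ∈ S → Star (EdgeAdjIn G S) a b
    connected a b a∈S b∈S with a ≟ b
    ... | yes refl = ε
    ... | no a≢b = viaNeighbour (anotherEdgeAt G deg≡2 (inc-nonLoop a∈S (proj₁ (contracts a a∈S)) false))
      where
      deg≡2 : deg S (r G a false) ≡ 2
      deg≡2 = zeroOrTwo-≥1 (deg≥1 a∈S (false , refl)) (degrees (r G a false))
      viaNeighbour : (∃ λ z → a ≢ z × z ∈ S × IsEnd G z (r G a false)) → Star (EdgeAdjIn G S) a b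
      viaNeighbour (z , a≢z , z∈S , c , e) =
        (a∈S , z∈S , false , c , sym e)
        ◅ subst₂ (Star (EdgeAdjIn G S)) (punchIn-punchOut a≢z) (punchIn-punchOut a≢b) (C.lift a a∈S a∈S pathInC)
        where
        pathInC = proj₂ (proj₂ (cycleC a a∈S)) _ _ (punchOut-∈-removeAt S a≢z z∈S)
                                                   (punchOut-∈-removeAt S a≢b b∈S)

  cycle-shape : ∀ {S} → IsCycle G S → CycleShape G S
  cycle-shape {S} cyc@(nonempty , _) with any? (λ i → (i ∈? S) ×-dec (r G i false ≟ r G i true))
  ... | yes (i , i∈S , loop) = inj₁ (i , (λ nl → nl loop) , i∈S , loopCycle-single cyc i∈S loop)
  ... | no noLoop = inj₂ (nonempty , λ i i∈S →
                      let nl = λ loop → noLoop (i , i∈S , loop)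
                      in nl , Contraction.contractCycle G i nl i∈S cyc)

  criterion : ∀ S → IsCycle G S ⇔ CycleShape G S
  criterion S = mk⇔ cycle-shape [ singleLoop-cycle , contracts-cycle ]

deckEquiv-sym : ∀ {n p} {G G′ : LGraph n (suc p)} → DeckEquiv G G′ → DeckEquiv G′ G
deckEquiv-sym deck j =
  mk⇔ (Equivalence.from (proj₁ (deck j))) (Equivalence.to (proj₁ (deck j))) ,
  λ nl′ nl → Isomorphism.inverse (proj₂ (deck j) nl nl′)

-- The shape of a cycle is read off from the deck: which labels are loops, and
-- the contractions of the non-loops up to isomorphism.
shape-transfer : ∀ {n p} {G G′ : LGraph n (suc p)} {S} → DeckEquiv G G′ → CycleShape G S → CycleShape G′ S
shape-transfer deck (inj₁ (i , notNonLoop , i∈S , only)) =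
  inj₁ (i , notNonLoop ∘ Equivalence.from (proj₁ (deck i)) , i∈S , only)
shape-transfer {G′ = G′} {S} deck (inj₂ (nonempty , contracts)) = inj₂ (nonempty , transferred)
  where
  transferred : ∀ i → i ∈ S → Σ (NonLoop G′ i) λ nl′ → IsCycle (contract G′ i nl′) (removeAt S i)
  transferred i i∈S with contracts i i∈S
  ... | nl , cycle = nl′ , Isomorphism.cycle-to (proj₂ (deck i) nl nl′) cycle
    where nl′ = Equivalence.to (proj₁ (deck i)) nl

cycle-transfer : ∀ {n p} {G G′ : LGraph n (suc p)} {S} → DeckEquiv G G′ → IsCycle G S → IsCycle G′ S
cycle-transfer {G = G} {G′} {S} deck =
  Equivalence.from (CycleCriterion.criterion G′ S)
  ∘ shape-transfer deck
  ∘ Equivalence.to (CycleCriterion.criterion G S)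

-- The cycle sets agree in both directions (deck equivalence is symmetric).
proposition4p5 : ∀ (g n p : ℕ) → 0 < 3 * g + n ∸ 3 → (G G' : LGraph n (suc p))
    → IsStable G g → IsStable G' g → DeckEquiv G' G → SameCycleSet G' G
proposition4p5 g n p _ G G' _ _ deck S = mk⇔ (cycle-transfer deck) (cycle-transfer (deckEquiv-sym deck))
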